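{- Let $V = \{v_1,\dots,v_n\}$ be a finite set and let $\hat{G} \neq K_n$ be an astral on $V$. Then: (i) $\hat{G}$ has a unique maximal independent set of size $\geq 2$; (ii) every maximal independent set of $\hat{G}$ of size $\geq 2$ is also a maximum independent set; (iii) $\hat{G}$ is the union of stars centered at the vertices of $V \setminus I(\hat{G})$, where $I(\hat{G})$ denotes the maximum independent set of $\hat{G}$.
   Context: All graphs are simple undirected graphs on the vertex set $V$; $K_n$ is the complete graph on $V$. For a graph $\hat{G} = (V,\hat{E})$ and $v \in V$, let $\hat{G} \setminus v$ denote the graph $(V, \hat{E} \cup \{\{v,u\} : u \in V, u \neq v\})$ (i.e. all edges at $v$ are added). Astrals are defined recursively: the edgeless graph $(V,\emptyset)$ is an astral; if $\hat{G} \neq K_n$ is an astral and $v$ belongs to a maximum-size independent set of $\hat{G}$, then $\hat{G} \setminus v$ is an astral. -}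

module Defs where

open import Data.Nat using (ℕ; _≤_)
open import Data.Bool using (Bool; true; false; _∨_)
open import Data.Fin using (Fin)
open import Data.Fin.Properties using (_≟_)
open import Data.Fin.Subset using (Subset; _∈_; _⊆_; ∣_∣)
open import Data.Product using (_×_)
open import Relation.Nullary using (¬_; yes; no)
open import Relation.Binary.PropositionalEquality using (_≡_; _≢_)

Graph : ℕ → Set
Graph n = Fin n → Fin n → Bool

Adj : ∀ {n} → Graph n → Fin n → Fin n → Set
Adj G u w = G u w ≡ true

edgeless : ∀ {n} → Graph n
edgeless _ _ = false

IsComplete : ∀ {n} → Graph n → Set
IsComplete G = ∀ u w → u ≢ w → Adj G u w

at : ∀ {n} → Fin n → Fin n → Bool
at v u with u ≟ v
... | yes _ = true
... | no _ = false

neq : ∀ {n} → Fin n → Fin n → Bool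
neq u w with u ≟ w
... | yes _ = false
... | no _ = true

-- G \ v : add all edges {v,u}, u ≠ v
addStar : ∀ {n} → Graph n → Fin n → Graph n
addStar G v u w = G u w ∨ ((at v u ∨ at v w) Data.Bool.∧ neq u w)

Independent : ∀ {n} → Graph n → Subset n → Set
Independent G S = ∀ u w → u ∈ S → w ∈ S → ¬ Adj G u w

IsMaximumIndep : ∀ {n} → Graph n → Subset n → Set
IsMaximumIndep G S = Independent G S × (∀ T → Independent G T → ∣ T ∣ ≤ ∣ S ∣)

IsMaximalIndep : ∀ {n} → Graph n → Subset n → Set
IsMaximalIndep G S = Independent G S × (∀ T → Independent G T → S ⊆ T → T ⊆ S)

data Astral {n : ℕ} : Graph n → Set where
  base : Astral edgeless
  step : ∀ {G} {I : Subset n} {v : Fin n} → Astral G → ¬ IsComplete G →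
         IsMaximumIndep G I → v ∈ I → Astral (addStar G v)

module Submission where

-- Call G a "union of stars outside C" when two vertices are
-- adjacent exactly if they are distinct and at least one of them lies
-- outside C; then G is the union of the stars centred at the vertices of
-- V ∖ C, and C is independent.  The edgeless graph has this form with
-- C = V, and adding the star at v turns the form for C into the form for
-- C - v.  Hence every astral is a union of stars outside some C.
--
-- For such a graph an independent set meeting V ∖ C is a single vertex,
-- so every independent set of size ≥ 2 lies inside C.  If G is not
-- complete then ∣C∣ ≥ 2, and all three claims follow by counting: C is the
-- unique maximal independent set of size ≥ 2, it is maximum, and every
-- maximum independent set equals C, so (iii) is the star form itself.

open import Defs
open import Data.Nat using (ℕ; suc; _≤_; s≤s; z≤n; _≤?_)
open import Data.Nat.Properties using (≤-trans; ≤-pred; ≰⇒>; <-irrefl; <-≤-trans)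
open import Data.Bool using (Bool; true; false; _∨_; _∧_)
open import Data.Fin using (Fin)
open import Data.Fin.Properties using (_≟_)
open import Data.Fin.Subset using (Subset; _∈_; _∉_; ∣_∣; _⊆_; ⊤; _─_; _-_; ⁅_⁆; inside; outside)
open import Data.Fin.Subset.Properties
  using (_∈?_; ∈⊤; x∈⁅x⁆; x∈⁅y⁆⇒x≡y; x≢y⇒x∉⁅y⁆; ∣⁅x⁆∣≡1; p─q⊆p;
         x∈p∧x≢y⇒x∈p-y; ⊆-antisym; p⊆q⇒∣p∣≤∣q∣; p⊂q⇒∣p∣<∣q∣)
open import Data.Vec using (_∷_; here; there)
open import Data.Product using (_×_; _,_; ∃)
open import Data.Sum using (_⊎_; inj₁; inj₂)
open import Data.Empty using (⊥-elim)
open import Function.Bundles using (_⇔_; mk⇔; Equivalence)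
open import Relation.Nullary using (¬_; yes; no)
open import Relation.Binary.PropositionalEquality using (_≡_; _≢_; refl; sym; subst)

open Equivalence using (to; from)

∨-true : ∀ {a b : Bool} → a ∨ b ≡ true ⇔ (a ≡ true ⊎ b ≡ true)
∨-true {true}  = mk⇔ (λ _ → inj₁ refl) (λ _ → refl)
∨-true {false} = mk⇔ inj₂ (λ { (inj₁ ()) ; (inj₂ e) → e })

∧-true : ∀ {a b : Bool} → a ∧ b ≡ true ⇔ (a ≡ true × b ≡ true)
∧-true {true}  = mk⇔ (λ e → refl , e) (λ { (_ , e) → e })
∧-true {false} = mk⇔ (λ ()) (λ { (() , _) })

at-true : ∀ {n} {v u : Fin n} → at v u ≡ true ⇔ u ≡ v
at-true {v = v} {u} with u ≟ v
... | yes u≡v = mk⇔ (λ _ → u≡v) (λ _ → refl)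
... | no  u≢v = mk⇔ (λ ()) (λ u≡v → ⊥-elim (u≢v u≡v))

neq-true : ∀ {n} {u w : Fin n} → neq u w ≡ true ⇔ u ≢ w
neq-true {u = u} {w} with u ≟ w
... | yes u≡w = mk⇔ (λ ()) (λ u≢w → ⊥-elim (u≢w u≡w))
... | no  u≢w = mk⇔ (λ _ → u≢w) (λ _ → refl)

addStar-adj : ∀ {n} {G : Graph n} {v u w : Fin n} →
              Adj (addStar G v) u w ⇔ (Adj G u w ⊎ (u ≢ w × (u ≡ v ⊎ w ≡ v)))
addStar-adj {G = G} {v} {u} {w} = mk⇔ forward backward
  where
  forward : Adj (addStar G v) u w → Adj G u w ⊎ (u ≢ w × (u ≡ v ⊎ w ≡ v))
  forward e with to ∨-true e
  ... | inj₁ g = inj₁ g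
  ... | inj₂ s with to ∧-true s
  ... | endpoint , distinct with to (∨-true {at v u}) endpoint
  ...   | inj₁ au = inj₂ (to neq-true distinct , inj₁ (to at-true au))
  ...   | inj₂ aw = inj₂ (to neq-true distinct , inj₂ (to at-true aw))

  backward : Adj G u w ⊎ (u ≢ w × (u ≡ v ⊎ w ≡ v)) → Adj (addStar G v) u w
  backward (inj₁ g) = from ∨-true (inj₁ g)
  backward (inj₂ (u≢w , e)) =
    from (∨-true {G u w}) (inj₂ (from ∧-true (from ∨-true (endpoint e) , from neq-true u≢w)))
    where
    endpoint : u ≡ v ⊎ w ≡ v → at v u ≡ true ⊎ at v w ≡ true
    endpoint (inj₁ u≡v) = inj₁ (from at-true u≡v)
    endpoint (inj₂ w≡v) = inj₂ (from at-true w≡v)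

∈─⇒∉ : ∀ {n} (p q : Subset n) {x : Fin n} → x ∈ p ─ q → x ∉ q
∈─⇒∉ (_ ∷ p) (_ ∷ q) (there x∈p─q) (there x∈q) = ∈─⇒∉ p q x∈p─q x∈q
∈─⇒∉ (inside  ∷ _) (inside ∷ _) () here
∈─⇒∉ (outside ∷ _) (inside ∷ _) () here

∈-remove⇒≢ : ∀ {n} (p : Subset n) {x y : Fin n} → x ∈ p - y → x ≢ y
∈-remove⇒≢ p {y = y} x∈p-y refl = ∈─⇒∉ p ⁅ y ⁆ x∈p-y (x∈⁅x⁆ y)

∉-remove : ∀ {n} (p : Subset n) {x y : Fin n} → x ∉ p - y ⇔ (x ∉ p ⊎ x ≡ y)
∉-remove p {x} {y} = mk⇔ forward backward
  where
  forward : x ∉ p - y → x ∉ p ⊎ x ≡ y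
  forward x∉ with x ∈? p | x ≟ y
  ... | no  x∉p | _       = inj₁ x∉p
  ... | yes _   | yes x≡y = inj₂ x≡y
  ... | yes x∈p | no  x≢y = ⊥-elim (x∉ (x∈p∧x≢y⇒x∈p-y x∈p x≢y))

  backward : x ∉ p ⊎ x ≡ y → x ∉ p - y
  backward (inj₁ x∉p) x∈ = x∉p (p─q⊆p p ⁅ y ⁆ x∈)
  backward (inj₂ x≡y) x∈ = ∈-remove⇒≢ p x∈ x≡y

two-elements : ∀ {n} {p : Subset n} {u w : Fin n} → u ≢ w → u ∈ p → w ∈ p → 2 ≤ ∣ p ∣
two-elements {p = p} {u} {w} u≢w u∈p w∈p =
  subst (λ k → suc k ≤ ∣ p ∣) (∣⁅x⁆∣≡1 u)
    (p⊂q⇒∣p∣<∣q∣ (⁅u⁆⊆p , w , w∈p , x≢y⇒x∉⁅y⁆ (λ w≡u → u≢w (sym w≡u))))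
  where
  ⁅u⁆⊆p : ⁅ u ⁆ ⊆ p
  ⁅u⁆⊆p x∈⁅u⁆ = subst (_∈ p) (sym (x∈⁅y⁆⇒x≡y u x∈⁅u⁆)) u∈p

⊆-with-≥-size : ∀ {n} {p q : Subset n} → p ⊆ q → ∣ q ∣ ≤ ∣ p ∣ → q ⊆ p
⊆-with-≥-size {p = p} p⊆q ∣q∣≤∣p∣ {x} x∈q with x ∈? p
... | yes x∈p = x∈p
... | no  x∉p = ⊥-elim (<-irrefl refl (<-≤-trans (p⊂q⇒∣p∣<∣q∣ (p⊆q , x , x∈q , x∉p)) ∣q∣≤∣p∣))

UnionOfStars : ∀ {n} → Graph n → Subset n → Set
UnionOfStars G C = ∀ u w → Adj G u w ⇔ (u ≢ w × (u ∉ C ⊎ w ∉ C))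

edgeless-stars : ∀ {n} → UnionOfStars (edgeless {n}) ⊤
edgeless-stars u w = mk⇔ (λ ()) λ { (_ , inj₁ u∉⊤) → ⊥-elim (u∉⊤ ∈⊤)
                                  ; (_ , inj₂ w∉⊤) → ⊥-elim (w∉⊤ ∈⊤) }

addStar-stars : ∀ {n} {G : Graph n} {C : Subset n} (v : Fin n) →
                UnionOfStars G C → UnionOfStars (addStar G v) (C - v)
addStar-stars {G = G} {C} v stars u w = mk⇔ forward backward
  where
  forward : Adj (addStar G v) u w → u ≢ w × (u ∉ C - v ⊎ w ∉ C - v)
  forward e with to (addStar-adj {G = G} {v}) e
  ... | inj₁ g with to (stars u w) g
  ...   | u≢w , inj₁ u∉C = u≢w , inj₁ (from (∉-remove C) (inj₁ u∉C))
  ...   | u≢w , inj₂ w∉C = u≢w , inj₂ (from (∉-remove C) (inj₁ w∉C))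
  forward e | inj₂ (u≢w , inj₁ u≡v) = u≢w , inj₁ (from (∉-remove C) (inj₂ u≡v))
  forward e | inj₂ (u≢w , inj₂ w≡v) = u≢w , inj₂ (from (∉-remove C) (inj₂ w≡v))

  backward : u ≢ w × (u ∉ C - v ⊎ w ∉ C - v) → Adj (addStar G v) u w
  backward (u≢w , inj₁ u∉) with to (∉-remove C) u∉
  ... | inj₁ u∉C = from (addStar-adj {G = G} {v}) (inj₁ (from (stars u w) (u≢w , inj₁ u∉C)))
  ... | inj₂ u≡v = from (addStar-adj {G = G} {v}) (inj₂ (u≢w , inj₁ u≡v))
  backward (u≢w , inj₂ w∉) with to (∉-remove C) w∉
  ... | inj₁ w∉C = from (addStar-adj {G = G} {v}) (inj₁ (from (stars u w) (u≢w , inj₂ w∉C)))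
  ... | inj₂ w≡v = from (addStar-adj {G = G} {v}) (inj₂ (u≢w , inj₂ w≡v))

astral-stars : ∀ {n} {G : Graph n} → Astral G → ∃ λ C → UnionOfStars G C
astral-stars base = ⊤ , edgeless-stars
astral-stars (step {v = v} astral _ _ _) with astral-stars astral
... | C , stars = C - v , addStar-stars v stars

module IndependentSetsOfStars {n : ℕ} {G : Graph n} {C : Subset n}
                              (stars : UnionOfStars G C) where

  C-independent : Independent G C
  C-independent u w u∈C w∈C uw with to (stars u w) uw
  ... | _ , inj₁ u∉C = u∉C u∈C
  ... | _ , inj₂ w∉C = w∉C w∈C

  -- A centre is adjacent to every other vertex, so it is alone in any
  -- independent set containing it.
  centre-alone : ∀ T → Independent G T → ∀ {x} → x ∈ T → x ∉ C → ∣ T ∣ ≤ 1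
  centre-alone T indep {x} x∈T x∉C = subst (∣ T ∣ ≤_) (∣⁅x⁆∣≡1 x) (p⊆q⇒∣p∣≤∣q∣ T⊆⁅x⁆)
    where
    T⊆⁅x⁆ : T ⊆ ⁅ x ⁆
    T⊆⁅x⁆ {y} y∈T with y ≟ x
    ... | yes refl = x∈⁅x⁆ x
    ... | no  y≢x  = ⊥-elim (indep x y x∈T y∈T
                        (from (stars x y) ((λ x≡y → y≢x (sym x≡y)) , inj₁ x∉C)))

  large-independent⊆C : ∀ T → Independent G T → 2 ≤ ∣ T ∣ → T ⊆ C
  large-independent⊆C T indep 2≤∣T∣ {x} x∈T with x ∈? C
  ... | yes x∈C = x∈C
  ... | no  x∉C = ⊥-elim (<-irrefl refl (≤-trans 2≤∣T∣ (centre-alone T indep x∈T x∉C)))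

  -- Two distinct non-centres are non-adjacent, so if G is not complete
  -- then there are at least two non-centres.
  noncomplete⇒2≤∣C∣ : ¬ IsComplete G → 2 ≤ ∣ C ∣
  noncomplete⇒2≤∣C∣ incomplete with 2 ≤? ∣ C ∣
  ... | yes 2≤∣C∣ = 2≤∣C∣
  ... | no  2≰∣C∣ = ⊥-elim (incomplete λ u w u≢w → from (stars u w) (u≢w , centre u w u≢w))
    where
    centre : ∀ u w → u ≢ w → u ∉ C ⊎ w ∉ C
    centre u w u≢w with u ∈? C | w ∈? C
    ... | no  u∉C | _       = inj₁ u∉C
    ... | yes _   | no  w∉C = inj₂ w∉C
    ... | yes u∈C | yes w∈C = ⊥-elim (2≰∣C∣ (two-elements u≢w u∈C w∈C))

  module _ (incomplete : ¬ IsComplete G) where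

    2≤∣C∣ : 2 ≤ ∣ C ∣
    2≤∣C∣ = noncomplete⇒2≤∣C∣ incomplete

    -- C is a maximum independent set: small sets are beaten by ∣C∣ ≥ 2,
    -- large ones lie inside C.
    C-maximum : IsMaximumIndep G C
    C-maximum = C-independent , bound
      where
      bound : ∀ T → Independent G T → ∣ T ∣ ≤ ∣ C ∣
      bound T indep with 2 ≤? ∣ T ∣
      ... | yes 2≤∣T∣ = p⊆q⇒∣p∣≤∣q∣ (large-independent⊆C T indep 2≤∣T∣)
      ... | no  2≰∣T∣ = ≤-trans (≤-pred (≰⇒> 2≰∣T∣)) (≤-trans (s≤s z≤n) 2≤∣C∣)

    C-maximal : IsMaximalIndep G C
    C-maximal = C-independent , λ T indep C⊆T →
      large-independent⊆C T indep (≤-trans 2≤∣C∣ (p⊆q⇒∣p∣≤∣q∣ C⊆T))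

    maximal-unique : ∀ T → IsMaximalIndep G T → 2 ≤ ∣ T ∣ → T ≡ C
    maximal-unique T (indep , maximal) 2≤∣T∣ =
      ⊆-antisym T⊆C (maximal C C-independent T⊆C)
      where
      T⊆C : T ⊆ C
      T⊆C = large-independent⊆C T indep 2≤∣T∣

    maximum-unique : ∀ I → IsMaximumIndep G I → I ≡ C
    maximum-unique I (indep , maximum) = ⊆-antisym I⊆C (⊆-with-≥-size I⊆C ∣C∣≤∣I∣)
      where
      ∣C∣≤∣I∣ : ∣ C ∣ ≤ ∣ I ∣
      ∣C∣≤∣I∣ = maximum C C-independent

      I⊆C : I ⊆ C
      I⊆C = large-independent⊆C I indep (≤-trans 2≤∣C∣ ∣C∣≤∣I∣)

fact6 : ∀ (n : ℕ) (G : Graph n) → Astral G → ¬ IsComplete G →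
    (∃ λ S → IsMaximalIndep G S × 2 ≤ ∣ S ∣ ×
    (∀ T → IsMaximalIndep G T → 2 ≤ ∣ T ∣ → T ≡ S))
    × (∀ S → IsMaximalIndep G S → 2 ≤ ∣ S ∣ → IsMaximumIndep G S)
    × (∀ I → IsMaximumIndep G I → ∀ u w →
    Adj G u w ⇔ (u ≢ w × (u ∉ I ⊎ w ∉ I)))
fact6 n G astral incomplete with astral-stars astral
... | C , stars = unique-large-maximal , large-maximal-is-maximum , stars-at-maximum
  where
  open IndependentSetsOfStars stars

  unique-large-maximal : ∃ λ S → IsMaximalIndep G S × 2 ≤ ∣ S ∣ ×
                           (∀ T → IsMaximalIndep G T → 2 ≤ ∣ T ∣ → T ≡ S)
  unique-large-maximal = C , C-maximal incomplete , 2≤∣C∣ incomplete , maximal-unique incomplete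

  large-maximal-is-maximum : ∀ S → IsMaximalIndep G S → 2 ≤ ∣ S ∣ → IsMaximumIndep G S
  large-maximal-is-maximum S maximal 2≤∣S∣ =
    subst (IsMaximumIndep G) (sym (maximal-unique incomplete S maximal 2≤∣S∣)) (C-maximum incomplete)

  stars-at-maximum : ∀ I → IsMaximumIndep G I → UnionOfStars G I
  stars-at-maximum I maximum =
    subst (UnionOfStars G) (sym (maximum-unique incomplete I maximum)) stars
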